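{- Let $I_2$ and $I_3$ be disjoint finite sets, let $q : I_3 \to I_2$ be a map, and let $p \in [0, 1/2]$. Form a random set $S \subseteq I_2 \cup I_3$ as follows: for each $i \in I_2$ independently flip a fair coin; if heads, include $i$ in $S$ with probability $2p$; if tails, include each point of $q^{ -1}(i)$ in $S$ independently with probability $2p$ (all random choices independent). Then for every subset $T \subseteq I_3$ with $|T| = c$, the probability that no point of $T$ lies in $S$ is at most $\frac{1}{2} + \frac{1}{2}(1-2p)^c$.
   Formalization: The parameter p ranges over the rationals in $[0, 1/2]$. -}

module Defs where

open import Data.Bool using (Bool; true; false; not; _∧_; if_then_else_)
open import Data.Nat using (ℕ; zero; suc)
open import Data.Fin using (Fin)
import Data.Fin as F
open import Data.Sum using (_⊎_; inj₁; inj₂)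
open import Data.Product using (_×_; _,_)
open import Data.List using (List; []; _∷_; map; concatMap; foldr; allFin)
open import Data.Bool.ListAction using (and)
open import Data.Vec using (lookup)
open import Data.Fin.Subset using (Subset)
open import Data.Rational using (ℚ; 0ℚ; 1ℚ; ½; _+_; _*_; _-_)

_^ℚ_ : ℚ → ℕ → ℚ
x ^ℚ zero  = 1ℚ
x ^ℚ suc k = x * (x ^ℚ k)

sumℚ : List ℚ → ℚ
sumℚ = foldr _+_ 0ℚ

prodℚ : List ℚ → ℚ
prodℚ = foldr _*_ 1ℚ

consF : {k : ℕ} → Bool → (Fin k → Bool) → Fin (suc k) → Bool
consF b f F.zero    = b
consF b f (F.suc i) = f i

allBoolFns : (k : ℕ) → List (Fin k → Bool)
allBoolFns zero    = (λ ()) ∷ []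
allBoolFns (suc k) =
  concatMap (λ f → map (λ b → consF b f) (true ∷ false ∷ [])) (allBoolFns k)

bernWeight : (k : ℕ) → ℚ → (Fin k → Bool) → ℚ
bernWeight k r f = prodℚ (map (λ i → if f i then r else (1ℚ - r)) (allFin k))

-- Elementary outcomes of the experiment, with I₂ = Fin m, I₃ = Fin n
-- (disjoint by construction, being summands of Fin m ⊎ Fin n):
--   coin  i : result of the fair coin at i ∈ I₂ (true = heads),
--   x     i : Bernoulli(2p) deciding inclusion of i ∈ I₂ (used if heads),
--   y     j : Bernoulli(2p) deciding inclusion of j ∈ I₃ (used if tails at q j).
Outcome : ℕ → ℕ → Set
Outcome m n = (Fin m → Bool) × (Fin m → Bool) × (Fin n → Bool)

allOutcomes : (m n : ℕ) → List (Outcome m n)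
allOutcomes m n =
  concatMap (λ c → concatMap (λ x → map (λ y → (c , x , y)) (allBoolFns n))
                             (allBoolFns m))
            (allBoolFns m)

weight : (m n : ℕ) → ℚ → Outcome m n → ℚ
weight m n p (c , x , y) =
  bernWeight m ½ c * (bernWeight m (p + p) x * bernWeight n (p + p) y)

inS : {m n : ℕ} → (Fin n → Fin m) → Outcome m n → Fin m ⊎ Fin n → Bool
inS q (c , x , y) (inj₁ i) = c i ∧ x i
inS q (c , x , y) (inj₂ j) = not (c (q j)) ∧ y j

Pr : (m n : ℕ) → ℚ → (Outcome m n → Bool) → ℚ
Pr m n p E = sumℚ (map (λ ω → if E ω then weight m n p ω else 0ℚ) (allOutcomes m n))

missesT : {m n : ℕ} → (Fin n → Fin m) → Subset n → Outcome m n → Bool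
missesT {n = n} q T ω = and (map (λ j → not (lookup T j ∧ inS q ω (inj₂ j))) (allFin n))

{-# OPTIONS --safe #-}
-- Conditioning on the fair coins c, the point j ∈ T is missed with probability 1 - 2p if its
-- block q j came up tails and with probability 1 otherwise, independently over j.  Grouping
-- the points of T by block gives  Pr = ∏ᵢ (½ + ½ aᵢ)  with  aᵢ = (1 - 2p)^|T ∩ q⁻¹(i)|, and
-- ∏ᵢ (½ + ½ aᵢ) ≤ ½ + ½ ∏ᵢ aᵢ  for  aᵢ ∈ [0,1], by induction on the number of factors.
module Submission where

open import Defs
open import Data.Nat using (ℕ)
open import Data.Fin using (Fin)
open import Data.Fin.Subset using (Subset; ∣_∣)
open import Data.Rational using (ℚ; 0ℚ; 1ℚ; ½; _+_; _*_; _-_; _≤_)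
open import Relation.Binary.PropositionalEquality using (_≡_)

import Data.Nat as ℕ
import Data.Fin as F
open import Data.Fin.Properties using (_≟_)
open import Data.Bool using (Bool; true; false; not; _∧_; if_then_else_)
open import Data.Bool.ListAction using (and)
open import Data.List using (List; []; _∷_; map; concatMap; allFin; _++_)
open import Data.List.Properties using (map-++; map-tabulate)
open import Data.Product using (_×_; _,_; proj₁; proj₂)
open import Data.Vec using (lookup) renaming (_∷_ to _∷ᵥ_; [] to []ᵥ)
open import Data.Rational using (-_; nonNegative)
open import Data.Rational.Properties hiding (_≟_)
open import Data.Rational.Solver using (module +-*-Solver)
open import Function using (_∘_)
open import Relation.Nullary using (does)
open import Relation.Binary.PropositionalEquality
  using (refl; sym; trans; cong; cong₂; subst; module ≡-Reasoning)

∑ : {A : Set} → List A → (A → ℚ) → ℚ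
∑ l f = sumℚ (map f l)

∏ : {A : Set} → List A → (A → ℚ) → ℚ
∏ l f = prodℚ (map f l)

syntax ∑ l (λ x → e) = ∑[ x ∈ l ] e
syntax ∏ l (λ x → e) = ∏[ x ∈ l ] e

if-*ʳ : ∀ b k w → (if b then k * w else 0ℚ) ≡ k * (if b then w else 0ℚ)
if-*ʳ true  k w = refl
if-*ʳ false k w = sym (*-zeroʳ k)

module _ {A : Set} where

  ∑-cong : (l : List A) {f g : A → ℚ} → (∀ x → f x ≡ g x) → ∑ l f ≡ ∑ l g
  ∑-cong []      f≡g = refl
  ∑-cong (x ∷ l) f≡g = cong₂ _+_ (f≡g x) (∑-cong l f≡g)

  ∏-cong : (l : List A) {f g : A → ℚ} → (∀ x → f x ≡ g x) → ∏ l f ≡ ∏ l g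
  ∏-cong []      f≡g = refl
  ∏-cong (x ∷ l) f≡g = cong₂ _*_ (f≡g x) (∏-cong l f≡g)

  *-distribˡ-∑ : (k : ℚ) (l : List A) (f : A → ℚ) → k * ∑ l f ≡ ∑[ x ∈ l ] (k * f x)
  *-distribˡ-∑ k []      f = *-zeroʳ k
  *-distribˡ-∑ k (x ∷ l) f =
    trans (*-distribˡ-+ k (f x) (∑ l f)) (cong (k * f x +_) (*-distribˡ-∑ k l f))

  ∏-1 : (l : List A) {f : A → ℚ} → (∀ x → f x ≡ 1ℚ) → ∏ l f ≡ 1ℚ
  ∏-1 []      f≡1 = refl
  ∏-1 (x ∷ l) f≡1 = trans (cong₂ _*_ (f≡1 x) (∏-1 l f≡1)) (*-identityˡ 1ℚ)

  ∏-distrib-* : (l : List A) (f g : A → ℚ) → ∏[ x ∈ l ] (f x * g x) ≡ ∏ l f * ∏ l g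
  ∏-distrib-* []      f g = refl
  ∏-distrib-* (x ∷ l) f g =
    trans (cong (f x * g x *_) (∏-distrib-* l f g)) (interchange (f x) (g x) (∏ l f) (∏ l g))
    where
    open +-*-Solver
    interchange : ∀ a b c d → (a * b) * (c * d) ≡ (a * c) * (b * d)
    interchange = solve 4 (λ a b c d → (a :* b) :* (c :* d) := (a :* c) :* (b :* d)) refl

  ∏-if-and : (l : List A) (β : A → Bool) (u : A → ℚ) →
    (if and (map β l) then ∏ l u else 0ℚ) ≡ ∏[ x ∈ l ] (if β x then u x else 0ℚ)
  ∏-if-and []      β u = refl
  ∏-if-and (x ∷ l) β u with β x
  ... | false = sym (*-zeroˡ (∏[ y ∈ l ] (if β y then u y else 0ℚ)))
  ... | true  = trans (if-*ʳ (and (map β l)) (u x) (∏ l u)) (cong (u x *_) (∏-if-and l β u))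

∏-swap : {A B : Set} (l₁ : List A) (l₂ : List B) (G : A → B → ℚ) →
  ∏[ a ∈ l₁ ] ∏ l₂ (G a) ≡ ∏[ b ∈ l₂ ] ∏[ a ∈ l₁ ] G a b
∏-swap []       l₂ G = sym (∏-1 l₂ (λ _ → refl))
∏-swap (x ∷ l₁) l₂ G =
  trans (cong (∏ l₂ (G x) *_) (∏-swap l₁ l₂ G)) (sym (∏-distrib-* l₂ (G x) _))

∑-++ : (xs ys : List ℚ) → sumℚ (xs ++ ys) ≡ sumℚ xs + sumℚ ys
∑-++ []       ys = sym (+-identityˡ _)
∑-++ (x ∷ xs) ys = trans (cong (x +_) (∑-++ xs ys)) (sym (+-assoc x _ _))

∑-concatMap : {A B : Set} (h : A → List B) (l : List A) (F : B → ℚ) →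
  ∑ (concatMap h l) F ≡ ∑[ a ∈ l ] ∑ (h a) F
∑-concatMap h []      F = refl
∑-concatMap h (x ∷ l) F = begin
  sumℚ (map F (h x ++ concatMap h l))          ≡⟨ cong sumℚ (map-++ F (h x) (concatMap h l)) ⟩
  sumℚ (map F (h x) ++ map F (concatMap h l))  ≡⟨ ∑-++ (map F (h x)) _ ⟩
  ∑ (h x) F + ∑ (concatMap h l) F              ≡⟨ cong (∑ (h x) F +_) (∑-concatMap h l F) ⟩
  ∑ (h x) F + ∑[ a ∈ l ] ∑ (h a) F             ∎
  where open ≡-Reasoning

∑-map : {A B : Set} (g : A → B) (l : List A) (F : B → ℚ) → ∑ (map g l) F ≡ ∑ l (F ∘ g)
∑-map g []      F = refl
∑-map g (x ∷ l) F = cong (F (g x) +_) (∑-map g l F)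

∏-allFin-suc : (k : ℕ) (f : Fin (ℕ.suc k) → ℚ) →
  ∏ (allFin (ℕ.suc k)) f ≡ f F.zero * ∏[ i ∈ allFin k ] f (F.suc i)
∏-allFin-suc k f =
  cong (λ xs → prodℚ (f F.zero ∷ xs))
       (trans (map-tabulate F.suc f) (sym (map-tabulate (λ i → i) (f ∘ F.suc))))

∑-allBoolFns-∏ : (k : ℕ) (g : Fin k → Bool → ℚ) →
  ∑[ f ∈ allBoolFns k ] ∏[ i ∈ allFin k ] g i (f i) ≡ ∏[ i ∈ allFin k ] (g i true + g i false)
∑-allBoolFns-∏ ℕ.zero    g = +-identityʳ 1ℚ
∑-allBoolFns-∏ (ℕ.suc k) g = begin
  ∑ (allBoolFns (ℕ.suc k)) (λ f → ∏[ i ∈ allFin (ℕ.suc k) ] g i (f i))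
    ≡⟨ ∑-concatMap _ (allBoolFns k) _ ⟩
  ∑[ f ∈ allBoolFns k ] (∏ (allFin (ℕ.suc k)) (λ i → g i (consF true f i))
                        + (∏ (allFin (ℕ.suc k)) (λ i → g i (consF false f i)) + 0ℚ))
    ≡⟨ ∑-cong (allBoolFns k) split-head ⟩
  ∑[ f ∈ allBoolFns k ] (g₀ * ∏[ i ∈ allFin k ] g (F.suc i) (f i))
    ≡⟨ sym (*-distribˡ-∑ g₀ (allBoolFns k) _) ⟩
  g₀ * ∑[ f ∈ allBoolFns k ] ∏[ i ∈ allFin k ] g (F.suc i) (f i)
    ≡⟨ cong (g₀ *_) (∑-allBoolFns-∏ k (g ∘ F.suc)) ⟩
  g₀ * ∏[ i ∈ allFin k ] (g (F.suc i) true + g (F.suc i) false)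
    ≡⟨ sym (∏-allFin-suc k (λ i → g i true + g i false)) ⟩
  ∏[ i ∈ allFin (ℕ.suc k) ] (g i true + g i false)
    ∎
  where
  open ≡-Reasoning
  g₀ : ℚ
  g₀ = g F.zero true + g F.zero false
  split-head : ∀ f →
    ∏ (allFin (ℕ.suc k)) (λ i → g i (consF true f i))
      + (∏ (allFin (ℕ.suc k)) (λ i → g i (consF false f i)) + 0ℚ)
    ≡ g₀ * ∏[ i ∈ allFin k ] g (F.suc i) (f i)
  split-head f = trans
    (cong₂ _+_ (∏-allFin-suc k (λ i → g i (consF true f i)))
               (trans (+-identityʳ _) (∏-allFin-suc k (λ i → g i (consF false f i)))))
    (sym (*-distribʳ-+ _ (g F.zero true) (g F.zero false)))

bern : ℚ → Bool → ℚ
bern r b = if b then r else 1ℚ - r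

bern-total : ∀ r → bern r true + bern r false ≡ 1ℚ
bern-total = solve 1 (λ r → r :+ (con 1ℚ :- r) := con 1ℚ) refl
  where open +-*-Solver

∑-bernWeight : (k : ℕ) (r : ℚ) → ∑ (allBoolFns k) (bernWeight k r) ≡ 1ℚ
∑-bernWeight k r = trans (∑-allBoolFns-∏ k (λ _ → bern r)) (∏-1 (allFin k) (λ _ → bern-total r))

∏-select : (m : ℕ) (k : Fin m) (w : Fin m → ℚ) →
  ∏[ i ∈ allFin m ] (if does (k ≟ i) then w i else 1ℚ) ≡ w k
∏-select (ℕ.suc m) k w = trans (∏-allFin-suc m (λ i → if does (k ≟ i) then w i else 1ℚ)) (head k)
  where
  head : (k : Fin (ℕ.suc m)) →
    (if does (k ≟ F.zero) then w F.zero else 1ℚ) * ∏[ i ∈ allFin m ] (if does (k ≟ F.suc i) then w (F.suc i) else 1ℚ)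
    ≡ w k
  head F.zero    = trans (cong (w F.zero *_) (∏-1 (allFin m) (λ _ → refl))) (*-identityʳ _)
  head (F.suc k) = trans (*-identityˡ _) (∏-select m k (w ∘ F.suc))

∏-lookup-pow : (a : ℚ) (n : ℕ) (T : Subset n) →
  ∏[ j ∈ allFin n ] (if lookup T j then a else 1ℚ) ≡ a ^ℚ ∣ T ∣
∏-lookup-pow a ℕ.zero    []ᵥ      = refl
∏-lookup-pow a (ℕ.suc n) (b ∷ᵥ T) =
  trans (∏-allFin-suc n (λ j → if lookup (b ∷ᵥ T) j then a else 1ℚ)) (head b)
  where
  head : ∀ b → (if b then a else 1ℚ) * ∏[ j ∈ allFin n ] (if lookup T j then a else 1ℚ)
               ≡ a ^ℚ ∣ b ∷ᵥ T ∣
  head true  = cong (a *_) (∏-lookup-pow a n T)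
  head false = trans (*-identityˡ _) (∏-lookup-pow a n T)

InUnit : ℚ → Set
InUnit x = 0ℚ ≤ x × x ≤ 1ℚ

1-inUnit : InUnit 1ℚ
1-inUnit = nonNegative⁻¹ 1ℚ , ≤-refl

0≤-* : ∀ {x y} → 0ℚ ≤ x → 0ℚ ≤ y → 0ℚ ≤ x * y
0≤-* {x} {y} 0≤x 0≤y =
  nonNegative⁻¹ (x * y) {{nonNeg*nonNeg⇒nonNeg x {{nonNegative 0≤x}} y {{nonNegative 0≤y}}}}

0≤1- : ∀ {x} → x ≤ 1ℚ → 0ℚ ≤ 1ℚ - x
0≤1- {x} x≤1 = subst (_≤ 1ℚ - x) (+-inverseʳ x) (+-monoˡ-≤ (- x) x≤1)

*-inUnit : ∀ {x y} → InUnit x → InUnit y → InUnit (x * y)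
*-inUnit {x} {y} (0≤x , x≤1) (0≤y , y≤1) = 0≤-* 0≤x 0≤y , (begin
  x * y   ≤⟨ *-monoˡ-≤-nonNeg x {{nonNegative 0≤x}} y≤1 ⟩
  x * 1ℚ  ≡⟨ *-identityʳ x ⟩
  x       ≤⟨ x≤1 ⟩
  1ℚ      ∎)
  where open ≤-Reasoning

∏-inUnit : {A : Set} (l : List A) (g : A → ℚ) → (∀ x → InUnit (g x)) → InUnit (∏ l g)
∏-inUnit []      g g∈I = 1-inUnit
∏-inUnit (x ∷ l) g g∈I = *-inUnit (g∈I x) (∏-inUnit l g g∈I)

-- The defect  (½ + ½ x)(½ + ½ y) - (½ + ½ xy) = -¼ (1 - x)(1 - y)  is nonpositive on [0,1]².
½+½*-∏-≤ : {A : Set} (l : List A) (g : A → ℚ) → (∀ x → InUnit (g x)) →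
  ∏[ x ∈ l ] (½ + ½ * g x) ≤ ½ + ½ * ∏ l g
½+½*-∏-≤ []      g g∈I = ≤-refl
½+½*-∏-≤ (x ∷ l) g g∈I = begin
  (½ + ½ * g x) * ∏[ y ∈ l ] (½ + ½ * g y)
    ≤⟨ *-monoˡ-≤-nonNeg (½ + ½ * g x) {{nonNegative 0≤head}} (½+½*-∏-≤ l g g∈I) ⟩
  (½ + ½ * g x) * (½ + ½ * P)
    ≤⟨ x≤x+y _ (0≤-* (0≤-* 0≤½ (0≤1- (proj₂ (g∈I x)))) (0≤-* 0≤½ (0≤1- (proj₂ (∏-inUnit l g g∈I))))) ⟩
  (½ + ½ * g x) * (½ + ½ * P) + (½ * (1ℚ - g x)) * (½ * (1ℚ - P))
    ≡⟨ mixing (g x) P ⟩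
  ½ + ½ * (g x * P)
    ∎
  where
  open ≤-Reasoning
  P : ℚ
  P = ∏ l g
  0≤½ : 0ℚ ≤ ½
  0≤½ = nonNegative⁻¹ ½
  0≤head : 0ℚ ≤ ½ + ½ * g x
  0≤head = +-mono-≤ 0≤½ (0≤-* 0≤½ (proj₁ (g∈I x)))
  x≤x+y : ∀ u {v} → 0ℚ ≤ v → u ≤ u + v
  x≤x+y u {v} 0≤v = subst (_≤ u + v) (+-identityʳ u) (+-monoʳ-≤ u 0≤v)
  mixing : ∀ u v → (½ + ½ * u) * (½ + ½ * v) + (½ * (1ℚ - u)) * (½ * (1ℚ - v)) ≡ ½ + ½ * (u * v)
  mixing = solve 2 (λ u v → (con ½ :+ con ½ :* u) :* (con ½ :+ con ½ :* v)
                             :+ (con ½ :* (con 1ℚ :- u)) :* (con ½ :* (con 1ℚ :- v))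
                            := con ½ :+ con ½ :* (u :* v)) refl
    where open +-*-Solver

module MissProbability (m n : ℕ) (q : Fin n → Fin m) (p : ℚ) (T : Subset n) where

  a : ℚ
  a = 1ℚ - (p + p)

  missGivenCoin : Fin n → Bool → ℚ
  missGivenCoin j heads = if heads then 1ℚ else (if lookup T j then a else 1ℚ)

  missGivenCoins : (Fin m → Bool) → ℚ
  missGivenCoins c = ∏[ j ∈ allFin n ] missGivenCoin j (c (q j))

  blockMiss : Fin m → Bool → ℚ
  blockMiss i heads = ∏[ j ∈ allFin n ] (if does (q j ≟ i) then missGivenCoin j heads else 1ℚ)

  missWeight : (Fin m → Bool) → Fin n → Bool → ℚ
  missWeight c j b = if not (lookup T j ∧ (not (c (q j)) ∧ b)) then bern (p + p) b else 0ℚ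

  missWeight-total : ∀ c j → missWeight c j true + missWeight c j false ≡ missGivenCoin j (c (q j))
  missWeight-total c j with c (q j) | lookup T j
  ... | true  | true  = bern-total (p + p)
  ... | true  | false = bern-total (p + p)
  ... | false | true  = +-identityˡ a
  ... | false | false = bern-total (p + p)

  event : Outcome m n → ℚ
  event ω = if missesT q T ω then weight m n p ω else 0ℚ

  ∑-event-over-y : ∀ c x → ∑[ y ∈ allBoolFns n ] event (c , x , y)
                   ≡ (bernWeight m ½ c * bernWeight m (p + p) x) * missGivenCoins c
  ∑-event-over-y c x = begin
    ∑[ y ∈ allBoolFns n ] event (c , x , y)
      ≡⟨ ∑-cong (allBoolFns n) factor ⟩
    ∑[ y ∈ allBoolFns n ] (K * ∏[ j ∈ allFin n ] missWeight c j (y j))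
      ≡⟨ sym (*-distribˡ-∑ K (allBoolFns n) _) ⟩
    K * ∑[ y ∈ allBoolFns n ] ∏[ j ∈ allFin n ] missWeight c j (y j)
      ≡⟨ cong (K *_) (∑-allBoolFns-∏ n (missWeight c)) ⟩
    K * ∏[ j ∈ allFin n ] (missWeight c j true + missWeight c j false)
      ≡⟨ cong (K *_) (∏-cong (allFin n) (missWeight-total c)) ⟩
    K * missGivenCoins c
      ∎
    where
    open ≡-Reasoning
    wc wx K : ℚ
    wc = bernWeight m ½ c
    wx = bernWeight m (p + p) x
    K = wc * wx
    factor : ∀ y → event (c , x , y) ≡ K * ∏[ j ∈ allFin n ] missWeight c j (y j)
    factor y = begin
      (if b then wc * (wx * wy) else 0ℚ)  ≡⟨ if-*ʳ b wc (wx * wy) ⟩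
      wc * (if b then wx * wy else 0ℚ)    ≡⟨ cong (wc *_) (if-*ʳ b wx wy) ⟩
      wc * (wx * (if b then wy else 0ℚ))  ≡⟨ sym (*-assoc wc wx (if b then wy else 0ℚ)) ⟩
      K * (if b then wy else 0ℚ)          ≡⟨ cong (K *_) (∏-if-and (allFin n) missed (λ j → bern (p + p) (y j))) ⟩
      K * ∏[ j ∈ allFin n ] missWeight c j (y j) ∎
      where
      missed : Fin n → Bool
      missed j = not (lookup T j ∧ (not (c (q j)) ∧ y j))
      b : Bool
      b = missesT q T (c , x , y)
      wy : ℚ
      wy = bernWeight n (p + p) y

  Pr≡∑-coins : Pr m n p (missesT q T) ≡ ∑[ c ∈ allBoolFns m ] (bernWeight m ½ c * missGivenCoins c)
  Pr≡∑-coins = trans (∑-concatMap _ (allBoolFns m) event) (∑-cong (allBoolFns m) ∑-event-over-xy)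
    where
    ∑-event-over-xy : ∀ c → ∑ (concatMap (λ x → map (λ y → (c , x , y)) (allBoolFns n)) (allBoolFns m)) event
                 ≡ bernWeight m ½ c * missGivenCoins c
    ∑-event-over-xy c = begin
      ∑ (concatMap (λ x → map (λ y → (c , x , y)) (allBoolFns n)) (allBoolFns m)) event
        ≡⟨ ∑-concatMap _ (allBoolFns m) event ⟩
      ∑[ x ∈ allBoolFns m ] ∑ (map (λ y → (c , x , y)) (allBoolFns n)) event
        ≡⟨ ∑-cong (allBoolFns m) (λ x → trans (∑-map _ (allBoolFns n) event) (∑-event-over-y c x)) ⟩
      ∑[ x ∈ allBoolFns m ] ((wc * bernWeight m (p + p) x) * missGivenCoins c)
        ≡⟨ ∑-cong (allBoolFns m) (λ x → rearrange wc (bernWeight m (p + p) x) (missGivenCoins c)) ⟩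
      ∑[ x ∈ allBoolFns m ] ((wc * missGivenCoins c) * bernWeight m (p + p) x)
        ≡⟨ sym (*-distribˡ-∑ (wc * missGivenCoins c) (allBoolFns m) (bernWeight m (p + p))) ⟩
      (wc * missGivenCoins c) * ∑ (allBoolFns m) (bernWeight m (p + p))
        ≡⟨ trans (cong ((wc * missGivenCoins c) *_) (∑-bernWeight m (p + p))) (*-identityʳ _) ⟩
      wc * missGivenCoins c
        ∎
      where
      open ≡-Reasoning
      wc : ℚ
      wc = bernWeight m ½ c
      rearrange : ∀ u v w → (u * v) * w ≡ (u * w) * v
      rearrange = solve 3 (λ u v w → (u :* v) :* w := (u :* w) :* v) refl
        where open +-*-Solver

  missGivenCoins-factorises : ∀ c → missGivenCoins c ≡ ∏[ i ∈ allFin m ] blockMiss i (c i)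
  missGivenCoins-factorises c = begin
    ∏[ j ∈ allFin n ] missGivenCoin j (c (q j))
      ≡⟨ ∏-cong (allFin n) (λ j → sym (∏-select m (q j) (λ i → missGivenCoin j (c i)))) ⟩
    ∏[ j ∈ allFin n ] ∏[ i ∈ allFin m ] (if does (q j ≟ i) then missGivenCoin j (c i) else 1ℚ)
      ≡⟨ ∏-swap (allFin n) (allFin m) (λ j i → if does (q j ≟ i) then missGivenCoin j (c i) else 1ℚ) ⟩
    ∏[ i ∈ allFin m ] blockMiss i (c i)
      ∎
    where open ≡-Reasoning

  blockMiss-heads : ∀ i → blockMiss i true ≡ 1ℚ
  blockMiss-heads i = ∏-1 (allFin n) inBlock
    where
    inBlock : ∀ j → (if does (q j ≟ i) then 1ℚ else 1ℚ) ≡ 1ℚ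
    inBlock j with does (q j ≟ i)
    ... | true  = refl
    ... | false = refl

  Pr≡∏-blocks : Pr m n p (missesT q T) ≡ ∏[ i ∈ allFin m ] (½ + ½ * blockMiss i false)
  Pr≡∏-blocks = begin
    Pr m n p (missesT q T)
      ≡⟨ Pr≡∑-coins ⟩
    ∑[ c ∈ allBoolFns m ] (bernWeight m ½ c * missGivenCoins c)
      ≡⟨ ∑-cong (allBoolFns m) (λ c → trans (cong (bernWeight m ½ c *_) (missGivenCoins-factorises c))
                                            (sym (∏-distrib-* (allFin m) _ _))) ⟩
    ∑[ c ∈ allBoolFns m ] ∏[ i ∈ allFin m ] (bern ½ (c i) * blockMiss i (c i))
      ≡⟨ ∑-allBoolFns-∏ m (λ i b → bern ½ b * blockMiss i b) ⟩
    ∏[ i ∈ allFin m ] (½ * blockMiss i true + (1ℚ - ½) * blockMiss i false)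
      -- 1ℚ - ½ and ½ * 1ℚ compute to ½.
      ≡⟨ ∏-cong (allFin m) (λ i → cong (λ h → ½ * h + ½ * blockMiss i false) (blockMiss-heads i)) ⟩
    ∏[ i ∈ allFin m ] (½ + ½ * blockMiss i false)
      ∎
    where open ≡-Reasoning

  ∏-blockMiss-tails : ∏[ i ∈ allFin m ] blockMiss i false ≡ a ^ℚ ∣ T ∣
  ∏-blockMiss-tails = trans (sym (missGivenCoins-factorises (λ _ → false))) (∏-lookup-pow a n T)

  blockMiss-inUnit : 0ℚ ≤ p → p ≤ ½ → ∀ i → InUnit (blockMiss i false)
  blockMiss-inUnit 0≤p p≤½ i = ∏-inUnit (allFin n) _ inBlock
    where
    a∈I : InUnit a
    a∈I = 0≤1- (+-mono-≤ p≤½ p≤½) , +-monoʳ-≤ 1ℚ (neg-antimono-≤ (+-mono-≤ 0≤p 0≤p))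
    inBlock : ∀ j → InUnit (if does (q j ≟ i) then missGivenCoin j false else 1ℚ)
    inBlock j with does (q j ≟ i) | lookup T j
    ... | false | _     = 1-inUnit
    ... | true  | true  = a∈I
    ... | true  | false = 1-inUnit

proposition4p6 : (m n : ℕ) (q : Fin n → Fin m) (p : ℚ) → 0ℚ ≤ p → p ≤ ½ →
    (c : ℕ) (T : Subset n) → ∣ T ∣ ≡ c →
    Pr m n p (missesT q T) ≤ ½ + ½ * ((1ℚ - (p + p)) ^ℚ c)
proposition4p6 m n q p 0≤p p≤½ _ T refl = begin
  Pr m n p (missesT q T)                         ≡⟨ Pr≡∏-blocks ⟩
  ∏[ i ∈ allFin m ] (½ + ½ * blockMiss i false)  ≤⟨ ½+½*-∏-≤ (allFin m) _ (blockMiss-inUnit 0≤p p≤½) ⟩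
  ½ + ½ * ∏[ i ∈ allFin m ] blockMiss i false    ≡⟨ cong (λ t → ½ + ½ * t) ∏-blockMiss-tails ⟩
  ½ + ½ * (a ^ℚ ∣ T ∣)                           ∎
  where
  open ≤-Reasoning
  open MissProbability m n q p T
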